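{- Let $\mathbf{P}$ be a minimal oriented path with edges $e_0,\dots,e_{n-1}$, and let $\mathscr{P}=(e_0,\dots,e_{n-1})$ be its $(1,2)$-path representation, where each $e_i$ is regarded as the structure with two elements and a binary edge relation containing only the tuple $e_i$. Let $\mathbf{Q}=f_0,\dots,f_m$ be a minimal oriented path with $n$ edge levels (i.e., of height $n$). Then the oriented path $\xi(\mathscr{P},\mathbf{Q})$ is minimal and has the same height as $\mathbf{P}$.
   Context: Oriented paths are digraphs (structures with one binary relation $E$) with vertices $v_0,\dots,v_{q+1}$ and edges $e_i=(v_i,v_{i+1})$ (forward) or $(v_{i+1},v_i)$ (backward). $\mathrm{lev}$ is the least map to $\{0,1,\dots\}$ with $\mathrm{lev}(b)=\mathrm{lev}(a)+1$ for edges $(a,b)$; level of edge $(a,b)$ is $\mathrm{lev}(a)$; height is the maximum level. Minimal: there are a vertex $u$ with indegree 0, outdegree 1 and a vertex $v$ with indegree 1, outdegree 0 such that $u$ is the only vertex in the bottom level and $v$ the only vertex in the top level. A $(j,k)$-path representation of a structure $\mathbf{S}$ is $(\mathbf{S}_0,\dots,\mathbf{S}_{n-1})$ with $\mathbf{S}=\bigcup\mathbf{S}_\ell$ (union of universes and relations), elements of $S_i\cap S_{i'}$ ($i<i'$) in all $S_\ell$ for $i<\ell<i'$, $|S_\ell|\le k$, $|S_\ell\cap S_{\ell+1}|\le j$. Zigzag $\xi(\mathscr{S},\mathbf{Q})$ for $\mathscr{S}=(\mathbf{S}_0,\dots,\mathbf{S}_{n-1})$ and minimal $\mathbf{Q}=f_0,\dots,f_m$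 of height $n$: $\mathbf{S}_{f_0}$ is a disjoint copy of $\mathbf{S}_0$ with isomorphism $\varphi_{f_0}$; for $i\ge1$ take a fresh disjoint copy $\mathbf{S}'_{f_i}$ of $\mathbf{S}_{\mathrm{lev}(f_i)}$ with isomorphism $\varphi'_{f_i}$, $\ell=\mathrm{lev}(f_i)$, $\ell'=\ell-1$ if $f_i$ forward, $\ell+1$ if backward, rename $\varphi'^{ -1}_{f_i}(a)$ to $\varphi^{ -1}_{f_{i-1}}(a)$ for all $a\in S_\ell\cap S_{\ell'}$ to get $\mathbf{S}_{f_i}$, and $\varphi_{f_i}$ equals $\varphi_{f_{i-1}}$ on shared elements and $\varphi'_{f_i}$ elsewhere. $\xi(\mathscr{S},\mathbf{Q})=\bigcup_i\mathbf{S}_{f_i}$. -}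

module Defs where

open import Data.Nat using (ℕ; zero; suc; _+_; _≤_; _<_; _∸_)
open import Data.Bool using (Bool; true; false; if_then_else_; _∧_)
open import Data.Fin using (Fin; zero; suc; inject₁; toℕ; fromℕ<)
open import Data.Fin.Properties using (toℕ<n) renaming (_≟_ to _≟F_)
open import Data.Product using (Σ; ∃; ∃₂; _×_; _,_; proj₁; proj₂)
open import Data.List using (List; []; _∷_; map; concat; allFin; concatMap)
open import Data.List.Membership.Propositional using (_∈_)
import Data.List.Membership.DecPropositional as DecMem
open import Data.Nat.Properties using (<-trans; n<1+n) renaming (_≟_ to _≟ℕ_)
open import Data.Product.Properties using (≡-dec)
open import Relation.Binary.PropositionalEquality using (_≡_; _≢_)
open import Relation.Binary.Definitions using (DecidableEquality)
open import Relation.Nullary.Decidable using (⌊_⌋)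
open import Function.Bundles using (_⇔_)
open import Function.Definitions using (Injective)

-- An oriented path with vertices v_0,…,v_{q+1} and edges e_0,…,e_q,
-- where dir i = true means e_i = (v_i , v_{i+1}) (forward) and
-- dir i = false means e_i = (v_{i+1} , v_i) (backward).

record OPath : Set where
  constructor opath
  field
    q   : ℕ
    dir : Fin (suc q) → Bool
open OPath public

nEdges : OPath → ℕ
nEdges P = suc (q P)

Vertex : OPath → Set
Vertex P = Fin (suc (suc (q P)))

EdgeIx : OPath → Set
EdgeIx P = Fin (suc (q P))

tl : (P : OPath) → EdgeIx P → Vertex P
tl P i = if dir P i then inject₁ i else suc i

hd : (P : OPath) → EdgeIx P → Vertex P
hd P i = if dir P i then suc i else inject₁ i

Edge : (P : OPath) → Vertex P → Vertex P → Set
Edge P a b = ∃ λ i → tl P i ≡ a × hd P i ≡ b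

countFin : (n : ℕ) → (Fin n → Bool) → ℕ
countFin zero    p = 0
countFin (suc n) p = (if p zero then 1 else 0) + countFin n (λ i → p (suc i))

indeg : (P : OPath) → Vertex P → ℕ
indeg P v = countFin (nEdges P) (λ i → ⌊ hd P i ≟F v ⌋)

outdeg : (P : OPath) → Vertex P → ℕ
outdeg P v = countFin (nEdges P) (λ i → ⌊ tl P i ≟F v ⌋)

IsLevelMap : (P : OPath) → (Vertex P → ℕ) → Set
IsLevelMap P l = ∀ a b → Edge P a b → l b ≡ suc (l a)

IsLev : (P : OPath) → (Vertex P → ℕ) → Set
IsLev P l = IsLevelMap P l × (∀ g → IsLevelMap P g → ∀ v → l v ≤ g v)

HasHeight : OPath → ℕ → Set
HasHeight P h = ∃ λ l → IsLev P l × (∀ v → l v ≤ h) × (∃ λ v → l v ≡ h)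

IsMinimal : OPath → Set
IsMinimal P = ∃ λ l → IsLev P l × ∃₂ λ u v →
  (indeg P u ≡ 0 × outdeg P u ≡ 1 × indeg P v ≡ 1 × outdeg P v ≡ 0) ×
  (∀ w → w ≢ u → l u < l w) ×
  (∀ w → w ≢ v → l w < l v)

record Structure (A : Set) : Set where
  constructor struct
  field
    U : List A
    E : List (A × A)
open Structure public

emptyS : {A : Set} → Structure A
emptyS = struct [] []

IsoToPath : {A : Set} → Structure A → OPath → Set
IsoToPath {A} S R = Σ (Vertex R → A) λ f →
  Injective _≡_ _≡_ f ×
  (∀ x → (x ∈ U S) ⇔ (∃ λ v → f v ≡ x)) ×
  (∀ x y → ((x , y) ∈ E S) ⇔ (∃₂ λ v w → Edge R v w × f v ≡ x × f w ≡ y))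

edgeStructure : (P : OPath) → EdgeIx P → Structure (Vertex P)
edgeStructure P i = struct (tl P i ∷ hd P i ∷ []) ((tl P i , hd P i) ∷ [])

pathRep : (P : OPath) → List (Structure (Vertex P))
pathRep P = map (edgeStructure P) (allFin (nEdges P))

-- Zigzag ξ(𝒮, Q).
-- 𝒮 = (S_0,…,S_{n-1}) is given as a list; indices outside 0..n-1 denote
-- the empty structure (S_{-1} and S_n), so that S_ℓ ∩ S_{ℓ'} = ∅ there.
-- lQ is the level map lev of Q.  The copy S_{f_i} is realised with
-- elements tagged by ℕ: the element φ_{f_i}^{-1}(a) is  rep i a,
-- where a fresh copy of a at step i is (i , a).

nth : {A : Set} → List (Structure A) → ℕ → Structure A
nth []       _       = emptyS
nth (S ∷ Ss) zero    = S
nth (S ∷ Ss) (suc k) = nth Ss k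

module Zigzag {A : Set} (_≟A_ : DecidableEquality A)
              (𝒮 : List (Structure A)) (Q : OPath) (lQ : Vertex Q → ℕ) where

  open DecMem _≟A_ using (_∈?_)

  levE : EdgeIx Q → ℕ
  levE i = lQ (tl Q i)

  Sℓ : EdgeIx Q → Structure A
  Sℓ i = nth 𝒮 (levE i)

  Sℓ' : EdgeIx Q → Structure A
  Sℓ' i with dir Q i | levE i
  ... | true  | zero  = emptyS
  ... | true  | suc k = nth 𝒮 k
  ... | false | ℓ     = nth 𝒮 (suc ℓ)

  shared : EdgeIx Q → A → Bool
  shared i a = ⌊ a ∈? U (Sℓ i) ⌋ ∧ ⌊ a ∈? U (Sℓ' i) ⌋

  repAux : (k : ℕ) → k < nEdges Q → A → ℕ × A
  repAux zero    p a = (0 , a)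
  repAux (suc k) p a = if shared (fromℕ< p) a
                         then repAux k (<-trans (n<1+n k) p) a
                         else (suc k , a)

  rep : EdgeIx Q → A → ℕ × A
  rep i = repAux (toℕ i) (toℕ<n i)

  Sf : EdgeIx Q → Structure (ℕ × A)
  Sf i = struct (map (rep i) (U (Sℓ i)))
                (map (λ p → (rep i (proj₁ p) , rep i (proj₂ p))) (E (Sℓ i)))

  ξ : Structure (ℕ × A)
  ξ = struct (concatMap (λ i → U (Sf i)) (allFin (nEdges Q)))
             (concatMap (λ i → E (Sf i)) (allFin (nEdges Q)))

zigzag : {A : Set} → DecidableEquality A → List (Structure A) →
         (Q : OPath) → (Vertex Q → ℕ) → Structure (ℕ × A)
zigzag _≟A_ 𝒮 Q lQ = Zigzag.ξ _≟A_ 𝒮 Q lQ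

module Submission where

-- Send each vertex of Q at level L to the L-th vertex of P (fold). The edge f_i of Q, at level
-- ℓ, then goes onto e_ℓ, the structure S_{f_i} is copied from. For i > 0 the vertex shared by
-- f_{i-1} and f_i is interior to Q, so by minimality its level lies strictly between 0 and n;
-- hence its image lies in e_ℓ ∩ e_ℓ′, while the image of the other end of f_i does not. Each
-- step therefore glues on exactly one new vertex, and ξ is the path R with the shape of Q whose
-- i-th edge is oriented like e_ℓ. The levels of R are those of P pulled back along fold, and
-- each end of P pulls back to a single end of Q, so R is minimal with the height of P.

open import Defs
open import Data.Bool using (Bool; true; false; if_then_else_; _∧_; not)
open import Data.Bool.Properties using (∧-zeroʳ)
open import Data.Empty using (⊥-elim)
open import Data.Fin using (Fin; zero; suc; inject₁; toℕ; fromℕ<; lower₁)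
open import Data.Fin.Induction using (<-weakInduction)
open import Data.Fin.Properties
  using (_≟_; toℕ-injective; toℕ-inject₁; toℕ<n; toℕ-fromℕ<; fromℕ<-toℕ; inject₁-injective;
         inject₁-lower₁)
open import Data.List using (List; []; _∷_; allFin; concatMap; tabulate)
open import Data.List.Membership.Propositional using (_∈_; _∉_)
import Data.List.Membership.DecPropositional as DecMem
open import Data.List.Relation.Unary.Any using (here; there)
open import Data.List.Relation.Unary.Any.Properties using (tabulate⁺; tabulate⁻)
open import Data.List.Membership.Propositional.Properties using (∈-concatMap⁺; ∈-concatMap⁻)
open import Data.List.Properties using (map-tabulate)
open import Relation.Binary.Definitions using (DecidableEquality)
open import Data.Nat using (ℕ; zero; suc; _+_; _∸_; _≤_; _<_; z≤n; s≤s; s<s⁻¹)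
open import Data.Nat.Properties hiding (_≟_)
open import Data.Nat.Properties using () renaming (_≟_ to _≟ℕ_)
open import Data.Product using (Σ; ∃; ∃₂; _×_; _,_; proj₁; proj₂; map₂)
open import Data.Sum using (_⊎_; inj₁; inj₂; [_,_])
open import Function using (_∘_; id)
open import Function.Bundles using (_⇔_; mk⇔; Equivalence)
open import Function.Properties.Equivalence using () renaming (trans to ⇔-trans)
open import Function.Definitions using (Injective)
open import Algebra.Properties.CommutativeSemigroup +-commutativeSemigroup
  using (x∙yz≈y∙xz) renaming (interchange to +-interchange)
open import Relation.Binary.PropositionalEquality
  using (_≡_; _≢_; refl; sym; trans; cong; cong₂; subst; subst₂; module ≡-Reasoning)
open import Relation.Nullary using (¬_; yes; no)
open import Relation.Nullary.Decidable using (Dec; ⌊_⌋; dec-true; dec-false; isYes≗does)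

⌊⌋-true : ∀ {a} {A : Set a} (a? : Dec A) → A → ⌊ a? ⌋ ≡ true
⌊⌋-true a? a = trans (isYes≗does a?) (dec-true a? a)

⌊⌋-false : ∀ {a} {A : Set a} (a? : Dec A) → ¬ A → ⌊ a? ⌋ ≡ false
⌊⌋-false a? ¬a = trans (isYes≗does a?) (dec-false a? ¬a)

indicator : Bool → ℕ
indicator b = if b then 1 else 0

countFin-false : ∀ n (p : Fin n → Bool) → (∀ i → p i ≡ false) → countFin n p ≡ 0
countFin-false zero    p all-false = refl
countFin-false (suc n) p all-false
  rewrite all-false zero = countFin-false n (p ∘ suc) (all-false ∘ suc)

countFin-true : ∀ n (p : Fin n → Bool) i → p i ≡ true → 0 < countFin n p
countFin-true (suc n) p zero    pi≡true rewrite pi≡true = s≤s z≤n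
countFin-true (suc n) p (suc i) pi≡true =
  ≤-trans (countFin-true n (p ∘ suc) i pi≡true) (m≤n+m _ (indicator (p zero)))

countFin-+ : ∀ n (p r p′ r′ : Fin n → Bool) →
  (∀ i → indicator (p i) + indicator (r i) ≡ indicator (p′ i) + indicator (r′ i)) →
  countFin n p + countFin n r ≡ countFin n p′ + countFin n r′
countFin-+ zero    p r p′ r′ eq = refl
countFin-+ (suc n) p r p′ r′ eq = begin
  (indicator (p zero) + countFin n (p ∘ suc)) + (indicator (r zero) + countFin n (r ∘ suc))
    ≡⟨ +-interchange (indicator (p zero)) (countFin n (p ∘ suc)) (indicator (r zero)) _ ⟩
  (indicator (p zero) + indicator (r zero)) + (countFin n (p ∘ suc) + countFin n (r ∘ suc))
    ≡⟨ cong₂ _+_ (eq zero) (countFin-+ n (p ∘ suc) (r ∘ suc) (p′ ∘ suc) (r′ ∘ suc) (eq ∘ suc)) ⟩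
  (indicator (p′ zero) + indicator (r′ zero)) + (countFin n (p′ ∘ suc) + countFin n (r′ ∘ suc))
    ≡⟨ +-interchange (indicator (p′ zero)) (indicator (r′ zero)) (countFin n (p′ ∘ suc)) _ ⟩
  (indicator (p′ zero) + countFin n (p′ ∘ suc)) + (indicator (r′ zero) + countFin n (r′ ∘ suc)) ∎
  where open ≡-Reasoning

Incident : ∀ {m} → Fin (suc m) → Fin (suc (suc m)) → Set
Incident i v = v ≡ inject₁ i ⊎ v ≡ suc i

incident-cover : ∀ {m} (v : Fin (suc (suc m))) → ∃ λ i → Incident i v
incident-cover zero    = zero , inj₁ refl
incident-cover (suc i) = i , inj₂ refl

module _ (X : OPath) (i : EdgeIx X) where

  ends-forward : dir X i ≡ true → tl X i ≡ inject₁ i × hd X i ≡ suc i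
  ends-forward d rewrite d = refl , refl

  ends-backward : dir X i ≡ false → tl X i ≡ suc i × hd X i ≡ inject₁ i
  ends-backward d rewrite d = refl , refl

  tl-incident : Incident i (tl X i)
  tl-incident with dir X i
  ... | true  = inj₁ refl
  ... | false = inj₂ refl

  hd-incident : Incident i (hd X i)
  hd-incident with dir X i
  ... | true  = inj₂ refl
  ... | false = inj₁ refl

  incident⇒tl⊎hd : ∀ {v} → Incident i v → v ≡ tl X i ⊎ v ≡ hd X i
  incident⇒tl⊎hd v≡ with dir X i | v≡
  ... | true  | inj₁ refl = inj₁ refl
  ... | true  | inj₂ refl = inj₂ refl
  ... | false | inj₁ refl = inj₂ refl
  ... | false | inj₂ refl = inj₁ refl

-- The degree in the underlying undirected path; it depends on q X only, not on the orientation.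
incidence : (m : ℕ) → Fin (suc (suc m)) → ℕ
incidence m x = countFin (suc m) (λ i → ⌊ inject₁ i ≟ x ⌋) + countFin (suc m) (λ i → ⌊ suc i ≟ x ⌋)

outdeg+indeg≡incidence : ∀ X x → outdeg X x + indeg X x ≡ incidence (q X) x
outdeg+indeg≡incidence X x =
  countFin-+ (nEdges X) (λ i → ⌊ tl X i ≟ x ⌋) (λ i → ⌊ hd X i ≟ x ⌋)
                        (λ i → ⌊ inject₁ i ≟ x ⌋) (λ i → ⌊ suc i ≟ x ⌋) swap-ends
  where
  swap-ends : ∀ i → indicator ⌊ tl X i ≟ x ⌋ + indicator ⌊ hd X i ≟ x ⌋
                  ≡ indicator ⌊ inject₁ i ≟ x ⌋ + indicator ⌊ suc i ≟ x ⌋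
  swap-ends i with dir X i
  ... | true  = refl
  ... | false = +-comm (indicator ⌊ suc i ≟ x ⌋) _

incidence≡1⇒end : ∀ m x → incidence m x ≡ 1 → x ≡ zero ⊎ toℕ x ≡ suc m
incidence≡1⇒end m zero    _ = inj₁ refl
incidence≡1⇒end m (suc j) once with toℕ j ≟ℕ m
... | yes j≡m = inj₂ (cong suc j≡m)
... | no  j≢m = ⊥-elim (<-irrefl (sym once) (+-mono-≤ as-inject₁ as-suc))
  where
  m≢j : suc m ≢ toℕ (suc j)
  m≢j = j≢m ∘ sym ∘ suc-injective
  j′ = lower₁ (suc j) m≢j
  as-inject₁ = countFin-true (suc m) (λ i → ⌊ inject₁ i ≟ suc j ⌋) j′
                 (⌊⌋-true (inject₁ j′ ≟ suc j) (inject₁-lower₁ (suc j) m≢j))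
  as-suc = countFin-true (suc m) (λ i → ⌊ suc i ≟ suc j ⌋) j (⌊⌋-true (suc j ≟ suc j) refl)

module _ {X : OPath} where

  level-offset : ∀ {l g} → IsLevelMap X l → IsLevelMap X g →
                 ∀ x → l x + g zero ≡ l zero + g x
  level-offset {l} {g} l-lvl g-lvl = <-weakInduction (λ x → l x + g zero ≡ l zero + g x) refl step
    where
    step : ∀ i → l (inject₁ i) + g zero ≡ l zero + g (inject₁ i) →
                 l (suc i) + g zero ≡ l zero + g (suc i)
    step i ih with dir X i | l-lvl _ _ (i , refl , refl) | g-lvl _ _ (i , refl , refl)
    ... | true  | l-up | g-up rewrite l-up | g-up =
      trans (cong suc ih) (sym (+-suc (l zero) (g (inject₁ i))))
    ... | false | l-up | g-up rewrite l-up | g-up =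
      suc-injective (trans ih (+-suc (l zero) (g (suc i))))

  levelMap⇒lev : ∀ {l} → IsLevelMap X l → ∀ z → l z ≡ 0 → IsLev X l
  levelMap⇒lev {l} l-lvl z lz≡0 = l-lvl , below
    where
    below : ∀ g → IsLevelMap X g → ∀ v → l v ≤ g v
    below g g-lvl v = subst (l v ≤_) lv+gz≡gv (m≤m+n (l v) (g z))
      where
      g0≡l0+gz : g zero ≡ l zero + g z
      g0≡l0+gz = trans (cong (_+ g zero) (sym lz≡0)) (level-offset l-lvl g-lvl z)
      lv+gz≡gv : l v + g z ≡ g v
      lv+gz≡gv = +-cancelˡ-≡ (l zero) _ _ (begin
        l zero + (l v + g z) ≡⟨ x∙yz≈y∙xz (l zero) (l v) (g z) ⟩
        l v + (l zero + g z) ≡⟨ cong (l v +_) (sym g0≡l0+gz) ⟩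
        l v + g zero         ≡⟨ level-offset l-lvl g-lvl v ⟩
        l zero + g v         ∎)
        where open ≡-Reasoning

  lev-unique : ∀ {l g} → IsLev X l → IsLev X g → ∀ v → l v ≡ g v
  lev-unique (l-lvl , l-min) (g-lvl , g-min) v = ≤-antisym (l-min _ g-lvl v) (g-min _ l-lvl v)

  minimum-level : ∀ (l : Vertex X → ℕ) u → (∀ w → w ≢ u → l u < l w) → ∀ w → l u ≤ l w
  minimum-level l u u-bottom w with w ≟ u
  ... | yes refl = ≤-refl
  ... | no  w≢u  = <⇒≤ (u-bottom w w≢u)

  maximum-level : ∀ (l : Vertex X → ℕ) v → (∀ w → w ≢ v → l w < l v) → ∀ w → l w ≤ l v
  maximum-level l v v-top w with w ≟ v
  ... | yes refl = ≤-refl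
  ... | no  w≢v  = <⇒≤ (v-top w w≢v)

  -- Lowering a level map by its minimum gives a level map, so lev vanishes at its minimum.
  lev-minimum≡0 : ∀ {l} → IsLev X l → (u : Vertex X) → (∀ w → w ≢ u → l u < l w) → l u ≡ 0
  lev-minimum≡0 {l} (l-lvl , l-min) u u-bottom =
    n≤0⇒n≡0 (subst (l u ≤_) (n∸n≡0 (l u)) (l-min lowered lowered-lvl u))
    where
    lowered : Vertex X → ℕ
    lowered w = l w ∸ l u
    lowered-lvl : IsLevelMap X lowered
    lowered-lvl a b e rewrite l-lvl a b e = +-∸-assoc 1 (minimum-level l u u-bottom a)

  indeg-level-zero : ∀ {l} → IsLevelMap X l → ∀ v → l v ≡ 0 → indeg X v ≡ 0
  indeg-level-zero l-lvl v lv≡0 = countFin-false (nEdges X) _ λ i →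
    ⌊⌋-false (hd X i ≟ v) λ hd≡v → 1+n≢0 (trans (sym (l-lvl _ _ (i , refl , hd≡v))) lv≡0)

  outdeg-top-level : ∀ {l} → IsLevelMap X l → ∀ v → (∀ w → l w ≤ l v) → outdeg X v ≡ 0
  outdeg-top-level {l} l-lvl v v-top = countFin-false (nEdges X) _ λ i →
    ⌊⌋-false (tl X i ≟ v) λ tl≡v →
      1+n≰n (subst (_≤ l v) (l-lvl _ _ (i , tl≡v , refl)) (v-top (hd X i)))

-- IsMinimal with lev fixed. Given the levels, the degree conditions on the extremes amount to
-- each having a single incident edge, which is orientation-free and so passes from Q to R.
record Minimal (X : OPath) (l : Vertex X → ℕ) : Set where
  field
    bottom top       : Vertex X
    bottom-incidence : incidence (q X) bottom ≡ 1
    top-incidence    : incidence (q X) top ≡ 1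
    bottom-level     : l bottom ≡ 0
    bottom-unique    : ∀ w → w ≢ bottom → l bottom < l w
    top-unique       : ∀ w → w ≢ top → l w < l top

module _ {X : OPath} {l : Vertex X → ℕ} (lev : IsLev X l) where

  isMinimal⇒Minimal : IsMinimal X → Minimal X l
  isMinimal⇒Minimal (l′ , lev′ , u , v , (in-u , out-u , in-v , out-v) , u-bottom , v-top) = record
    { bottom           = u
    ; top              = v
    ; bottom-incidence = trans (sym (outdeg+indeg≡incidence X u)) (cong₂ _+_ out-u in-u)
    ; top-incidence    = trans (sym (outdeg+indeg≡incidence X v)) (cong₂ _+_ out-v in-v)
    ; bottom-level     = lev-minimum≡0 lev u u-bottom′
    ; bottom-unique    = u-bottom′
    ; top-unique       = λ w w≢v → subst₂ _<_ (l′≡l w) (l′≡l v) (v-top w w≢v)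
    }
    where
    l′≡l : ∀ w → l′ w ≡ l w
    l′≡l = lev-unique lev′ lev
    u-bottom′ : ∀ w → w ≢ u → l u < l w
    u-bottom′ w w≢u = subst₂ _<_ (l′≡l u) (l′≡l w) (u-bottom w w≢u)

  module _ (min : Minimal X l) where
    open Minimal min

    top-maximum : ∀ w → l w ≤ l top
    top-maximum = maximum-level {X} l top top-unique

    Minimal⇒isMinimal : IsMinimal X
    Minimal⇒isMinimal = l , lev , bottom , top ,
      (in-bottom , out-bottom , in-top , out-top) , bottom-unique , top-unique
      where
      in-bottom = indeg-level-zero (proj₁ lev) bottom bottom-level
      out-top   = outdeg-top-level (proj₁ lev) top top-maximum
      out-bottom : outdeg X bottom ≡ 1
      out-bottom = begin
        outdeg X bottom                     ≡⟨ sym (+-identityʳ _) ⟩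
        outdeg X bottom + 0                 ≡⟨ cong (outdeg X bottom +_) (sym in-bottom) ⟩
        outdeg X bottom + indeg X bottom    ≡⟨ outdeg+indeg≡incidence X bottom ⟩
        incidence (q X) bottom              ≡⟨ bottom-incidence ⟩
        1                                   ∎
        where open ≡-Reasoning
      in-top : indeg X top ≡ 1
      in-top = trans (cong (_+ indeg X top) (sym out-top))
                     (trans (outdeg+indeg≡incidence X top) top-incidence)

    Minimal⇒height : HasHeight X (l top)
    Minimal⇒height = l , lev , top-maximum , top , refl

    height≡top-level : ∀ {h} → HasHeight X h → l top ≡ h
    height≡top-level {h} (l′ , lev′ , l′≤h , w , l′w≡h) = ≤-antisym
      (subst (_≤ h) (lev-unique lev′ lev top) (l′≤h top))
      (subst (_≤ l top) (trans (sym (lev-unique lev′ lev w)) l′w≡h) (top-maximum w))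

    interior-level : ∀ x → x ≢ zero → toℕ x ≢ suc (q X) → 0 < l x × l x < l top
    interior-level x x≢0 x≢last =
      subst (_< l x) bottom-level (bottom-unique x (not-end bottom-incidence)) ,
      top-unique x (not-end top-incidence)
      where
      not-end : ∀ {y} → incidence (q X) y ≡ 1 → x ≢ y
      not-end once refl with incidence≡1⇒end (q X) x once
      ... | inj₁ x≡0    = x≢0 x≡0
      ... | inj₂ x≡last = x≢last x≡last

module _ {X : OPath} {l : Vertex X → ℕ} (l-lvl : IsLevelMap X l) where

  levelMap-adjacent : ∀ i → l (inject₁ i) ≢ l (suc i)
  levelMap-adjacent i with dir X i | l-lvl _ _ (i , refl , refl)
  ... | true  | up = 1+n≢n ∘ trans (sym up) ∘ sym
  ... | false | up = 1+n≢n ∘ trans (sym up)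

  levelMap-∘ : ∀ {Y : OPath} (h : Vertex Y → Vertex X) →
               (∀ i → Edge X (h (tl Y i)) (h (hd Y i))) → IsLevelMap Y (l ∘ h)
  levelMap-∘ h h-edge _ _ (i , refl , refl) = l-lvl _ _ (h-edge i)

reorient : ∀ {m k} (h : Fin (suc (suc m)) → Fin (suc (suc k))) (i : Fin (suc m)) (e : Fin (suc k)) b c →
  h (if b then inject₁ i else suc i) ≡ inject₁ e → h (if b then suc i else inject₁ i) ≡ suc e →
  h (if (if b then c else not c) then inject₁ i else suc i) ≡ (if c then inject₁ e else suc e) ×
  h (if (if b then c else not c) then suc i else inject₁ i) ≡ (if c then suc e else inject₁ e)
reorient h i e true  true  tl↦ hd↦ = tl↦ , hd↦
reorient h i e true  false tl↦ hd↦ = hd↦ , tl↦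
reorient h i e false true  tl↦ hd↦ = tl↦ , hd↦
reorient h i e false false tl↦ hd↦ = hd↦ , tl↦

∈-concatMap-allFin : ∀ {B : Set} n (f : Fin n → List B) {y} →
                     y ∈ concatMap f (allFin n) ⇔ (∃ λ i → y ∈ f i)
∈-concatMap-allFin n f =
  mk⇔ (tabulate⁻ ∘ ∈-concatMap⁻ f) λ (i , y∈fi) → ∈-concatMap⁺ f (tabulate⁺ i y∈fi)

nth-tabulate : ∀ {A : Set} n (f : Fin n → Structure A) ℓ (ℓ<n : ℓ < n) →
               nth (tabulate f) ℓ ≡ f (fromℕ< ℓ<n)
nth-tabulate (suc n) f zero    _   = refl
nth-tabulate (suc n) f (suc ℓ) ℓ<n = nth-tabulate n (f ∘ suc) ℓ (s<s⁻¹ ℓ<n)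

nth-pathRep : ∀ X ℓ (ℓ<n : ℓ < nEdges X) → nth (pathRep X) ℓ ≡ edgeStructure X (fromℕ< ℓ<n)
nth-pathRep X ℓ ℓ<n rewrite map-tabulate id (edgeStructure X) = nth-tabulate _ (edgeStructure X) ℓ ℓ<n

∈-edgeStructure : ∀ X e v → v ∈ U (edgeStructure X e) ⇔ Incident e v
∈-edgeStructure X e v = mk⇔ to from
  where
  to : v ∈ U (edgeStructure X e) → Incident e v
  to (here refl)         = tl-incident X e
  to (there (here refl)) = hd-incident X e
  from : Incident e v → v ∈ U (edgeStructure X e)
  from v-inc with incident⇒tl⊎hd X e v-inc
  ... | inj₁ refl = here refl
  ... | inj₂ refl = there (here refl)

incident⇔toℕ : ∀ {m} (i : Fin (suc m)) v → Incident i v ⇔ (toℕ v ≡ toℕ i ⊎ toℕ v ≡ suc (toℕ i))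
incident⇔toℕ i v = mk⇔ to from
  where
  to : Incident i v → toℕ v ≡ toℕ i ⊎ toℕ v ≡ suc (toℕ i)
  to (inj₁ refl) = inj₁ (toℕ-inject₁ i)
  to (inj₂ refl) = inj₂ refl
  from : toℕ v ≡ toℕ i ⊎ toℕ v ≡ suc (toℕ i) → Incident i v
  from (inj₁ v≡i)   = inj₁ (toℕ-injective (trans v≡i (sym (toℕ-inject₁ i))))
  from (inj₂ v≡1+i) = inj₂ (toℕ-injective v≡1+i)

∈-nth-pathRep : ∀ X ℓ → ℓ < nEdges X → ∀ v →
                v ∈ U (nth (pathRep X) ℓ) ⇔ (toℕ v ≡ ℓ ⊎ toℕ v ≡ suc ℓ)
∈-nth-pathRep X ℓ ℓ<n v rewrite nth-pathRep X ℓ ℓ<n =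
  subst (λ k → v ∈ U (edgeStructure X e) ⇔ (toℕ v ≡ k ⊎ toℕ v ≡ suc k)) (toℕ-fromℕ< ℓ<n)
        (⇔-trans (∈-edgeStructure X e v) (incident⇔toℕ e v))
  where e = fromℕ< ℓ<n

module _ {A : Set} (_≟A_ : DecidableEquality A) (𝒮 : List (Structure A)) (Q : OPath) (lQ : Vertex Q → ℕ) where
  open Zigzag _≟A_ 𝒮 Q lQ

  Sℓ′-forward : ∀ i k → dir Q i ≡ true → levE i ≡ suc k → Sℓ' i ≡ nth 𝒮 k
  Sℓ′-forward i k d e with dir Q i | levE i | d | e
  ... | true | suc .k | refl | refl = refl

  Sℓ′-backward : ∀ i → dir Q i ≡ false → Sℓ' i ≡ nth 𝒮 (suc (levE i))
  Sℓ′-backward i d with dir Q i | d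
  ... | false | refl = refl

module PathRepZigzag (P Q : OPath) (lQ : Vertex Q → ℕ) (levQ : IsLev Q lQ)
                     (minQ : Minimal Q lQ) (top≡n : lQ (Minimal.top minQ) ≡ nEdges P) where

  open Minimal minQ
  module Z = Zigzag _≟_ (pathRep P) Q lQ

  lQ-edge : ∀ i → lQ (hd Q i) ≡ suc (Z.levE i)
  lQ-edge i = proj₁ levQ _ _ (i , refl , refl)

  lQ≤n : ∀ w → lQ w ≤ nEdges P
  lQ≤n w = subst (lQ w ≤_) top≡n (top-maximum levQ minQ w)

  levE<n : ∀ i → Z.levE i < nEdges P
  levE<n i = subst (_≤ nEdges P) (lQ-edge i) (lQ≤n (hd Q i))

  fold : Vertex Q → Vertex P
  fold w = fromℕ< (s≤s (lQ≤n w))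

  toℕ-fold : ∀ w → toℕ (fold w) ≡ lQ w
  toℕ-fold w = toℕ-fromℕ< (s≤s (lQ≤n w))

  foldEdge : EdgeIx Q → EdgeIx P
  foldEdge i = fromℕ< (levE<n i)

  R : OPath
  R = opath (q Q) λ i → if dir Q i then dir P (foldEdge i) else not (dir P (foldEdge i))

  -- The copy of vertex w is created at step w − 1 (step 0 for w = 0) and only renamed at step w.
  label : Vertex Q → ℕ × Vertex P
  label w = toℕ w ∸ 1 , fold w

  fold-tl : ∀ i → fold (tl Q i) ≡ inject₁ (foldEdge i)
  fold-tl i = toℕ-injective (begin
    toℕ (fold (tl Q i))         ≡⟨ toℕ-fold (tl Q i) ⟩
    Z.levE i                    ≡⟨ toℕ-fromℕ< (levE<n i) ⟨
    toℕ (foldEdge i)            ≡⟨ toℕ-inject₁ (foldEdge i) ⟨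
    toℕ (inject₁ (foldEdge i))  ∎)
    where open ≡-Reasoning

  fold-hd : ∀ i → fold (hd Q i) ≡ suc (foldEdge i)
  fold-hd i = toℕ-injective (begin
    toℕ (fold (hd Q i))  ≡⟨ toℕ-fold (hd Q i) ⟩
    lQ (hd Q i)          ≡⟨ lQ-edge i ⟩
    suc (Z.levE i)       ≡⟨ cong suc (toℕ-fromℕ< (levE<n i)) ⟨
    suc (toℕ (foldEdge i)) ∎)
    where open ≡-Reasoning

  fold-edge : ∀ i → fold (tl R i) ≡ tl P (foldEdge i) × fold (hd R i) ≡ hd P (foldEdge i)
  fold-edge i = reorient fold i (foldEdge i) (dir Q i) (dir P (foldEdge i)) (fold-tl i) (fold-hd i)

  fold-Edge : ∀ i → Edge P (fold (tl R i)) (fold (hd R i))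
  fold-Edge i = foldEdge i , sym (proj₁ (fold-edge i)) , sym (proj₂ (fold-edge i))

  fold-∈-nth : ∀ ℓ → ℓ < nEdges P → ∀ w →
               fold w ∈ U (nth (pathRep P) ℓ) ⇔ (lQ w ≡ ℓ ⊎ lQ w ≡ suc ℓ)
  fold-∈-nth ℓ ℓ<n w = subst (λ L → fold w ∈ U (nth (pathRep P) ℓ) ⇔ (L ≡ ℓ ⊎ L ≡ suc ℓ))
                             (toℕ-fold w) (∈-nth-pathRep P ℓ ℓ<n (fold w))

  Sℓ≡ : ∀ i → Z.Sℓ i ≡ edgeStructure P (foldEdge i)
  Sℓ≡ i = nth-pathRep P (Z.levE i) (levE<n i)

  fold-∈-Sℓ : ∀ i {v} → Incident i v → fold v ∈ U (Z.Sℓ i)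
  fold-∈-Sℓ i v-inc with incident⇒tl⊎hd Q i v-inc
  ... | inj₁ refl = Equivalence.from (fold-∈-nth _ (levE<n i) _) (inj₁ refl)
  ... | inj₂ refl = Equivalence.from (fold-∈-nth _ (levE<n i) _) (inj₂ (lQ-edge i))

  junction-level : ∀ i → i ≢ zero → 0 < lQ (inject₁ i) × lQ (inject₁ i) < nEdges P
  junction-level i i≢0 = map₂ (subst (lQ (inject₁ i) <_) top≡n)
    (interior-level levQ minQ (inject₁ i) (i≢0 ∘ inject₁-injective)
                    (<⇒≢ (subst (_< suc (q Q)) (sym (toℕ-inject₁ i)) (toℕ<n i))))

  -- Which end of f_i gets renamed to the copy made at step i − 1.
  Junction : EdgeIx Q → Set
  Junction i = fold (inject₁ i) ∈ U (Z.Sℓ' i) × fold (suc i) ∉ U (Z.Sℓ' i)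

  junction-forward : ∀ i → i ≢ zero → dir Q i ≡ true → Junction i
  junction-forward i i≢0 d = at-level (Z.levE i) refl
    where
    tl≡ = proj₁ (ends-forward Q i d)
    hd≡ = proj₂ (ends-forward Q i d)
    at-level : ∀ ℓ → Z.levE i ≡ ℓ → Junction i
    at-level zero    ℓ≡0 =
      ⊥-elim (<⇒≢ (proj₁ (junction-level i i≢0)) (sym (trans (cong lQ (sym tl≡)) ℓ≡0)))
    at-level (suc k) ℓ≡  rewrite Sℓ′-forward _≟_ (pathRep P) Q lQ i k d ℓ≡ =
      Equivalence.from (fold-∈-nth k k<n _) (inj₂ L≡) ,
      [ m≢1+n+m k {1} ∘ sym ∘ trans (sym 2+k≡) , 1+n≢n ∘ trans (sym 2+k≡) ]
        ∘ Equivalence.to (fold-∈-nth k k<n (suc i))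
      where
      L≡ : lQ (inject₁ i) ≡ suc k
      L≡ = trans (cong lQ (sym tl≡)) ℓ≡
      2+k≡ : lQ (suc i) ≡ suc (suc k)
      2+k≡ = trans (cong lQ (sym hd≡)) (trans (lQ-edge i) (cong suc ℓ≡))
      k<n : k < nEdges P
      k<n = <⇒≤ (subst (_< nEdges P) L≡ (proj₂ (junction-level i i≢0)))

  junction-backward : ∀ i → i ≢ zero → dir Q i ≡ false → Junction i
  junction-backward i i≢0 d rewrite Sℓ′-backward _≟_ (pathRep P) Q lQ i d =
    Equivalence.from (fold-∈-nth _ 1+ℓ<n _) (inj₁ L≡) ,
    [ 1+n≢n ∘ sym ∘ trans (sym ℓ≡) , m≢1+n+m ℓ {1} ∘ trans (sym ℓ≡) ]
      ∘ Equivalence.to (fold-∈-nth _ 1+ℓ<n (suc i))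
    where
    ℓ = Z.levE i
    tl≡ = proj₁ (ends-backward Q i d)
    hd≡ = proj₂ (ends-backward Q i d)
    ℓ≡ : lQ (suc i) ≡ ℓ
    ℓ≡ = cong lQ (sym tl≡)
    L≡ : lQ (inject₁ i) ≡ suc ℓ
    L≡ = trans (cong lQ (sym hd≡)) (lQ-edge i)
    1+ℓ<n : suc ℓ < nEdges P
    1+ℓ<n = subst (_< nEdges P) L≡ (proj₂ (junction-level i i≢0))

  junction : ∀ i → i ≢ zero → Junction i
  junction i i≢0 = by-direction (dir Q i) refl
    where
    by-direction : ∀ b → dir Q i ≡ b → Junction i
    by-direction true  = junction-forward i i≢0
    by-direction false = junction-backward i i≢0

  shared-junction : ∀ i → i ≢ zero → Z.shared i (fold (inject₁ i)) ≡ true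
  shared-junction i i≢0 = cong₂ _∧_ (⌊⌋-true (_ ∈? _) (fold-∈-Sℓ i (inj₁ refl)))
                                    (⌊⌋-true (_ ∈? _) (proj₁ (junction i i≢0)))
    where open DecMem (_≟_ {suc (nEdges P)}) using (_∈?_)

  shared-suc : ∀ i → i ≢ zero → Z.shared i (fold (suc i)) ≡ false
  shared-suc i i≢0 =
    trans (cong (in-Sℓ ∧_) (⌊⌋-false (_ ∈? _) (proj₂ (junction i i≢0)))) (∧-zeroʳ in-Sℓ)
    where
    open DecMem (_≟_ {suc (nEdges P)}) using (_∈?_)
    in-Sℓ = ⌊ fold (suc i) ∈? U (Z.Sℓ i) ⌋

  repAux-ends : ∀ k (k<m : k < nEdges Q) →
    Z.repAux k k<m (fold (inject₁ (fromℕ< k<m))) ≡ (k ∸ 1 , fold (inject₁ (fromℕ< k<m))) ×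
    Z.repAux k k<m (fold (suc (fromℕ< k<m)))     ≡ (k , fold (suc (fromℕ< k<m)))
  repAux-ends zero    _   = refl , refl
  repAux-ends (suc k) k<m = shared , fresh
    where
    i   = fromℕ< k<m
    k<m′ = <-trans (n<1+n k) k<m
    i≢0 : i ≢ zero
    i≢0 ()
    i-1 : inject₁ i ≡ suc (fromℕ< k<m′)
    i-1 = toℕ-injective
      (trans (toℕ-inject₁ i) (trans (toℕ-fromℕ< k<m) (cong suc (sym (toℕ-fromℕ< k<m′)))))
    shared : Z.repAux (suc k) k<m (fold (inject₁ i)) ≡ (k , fold (inject₁ i))
    shared rewrite shared-junction i i≢0 | i-1 = proj₂ (repAux-ends k k<m′)
    fresh : Z.repAux (suc k) k<m (fold (suc i)) ≡ (suc k , fold (suc i))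
    fresh rewrite shared-suc i i≢0 = refl

  rep-ends : ∀ i → Z.rep i (fold (inject₁ i)) ≡ (toℕ i ∸ 1 , fold (inject₁ i)) ×
                   Z.rep i (fold (suc i))     ≡ (toℕ i , fold (suc i))
  rep-ends i = subst
    (λ j → Z.repAux (toℕ i) (toℕ<n i) (fold (inject₁ j)) ≡ (toℕ i ∸ 1 , fold (inject₁ j)) ×
           Z.repAux (toℕ i) (toℕ<n i) (fold (suc j))     ≡ (toℕ i , fold (suc j)))
    (fromℕ<-toℕ i (toℕ<n i)) (repAux-ends (toℕ i) (toℕ<n i))

  rep-fold : ∀ i {v} → Incident i v → Z.rep i (fold v) ≡ label v
  rep-fold i (inj₁ refl) =
    trans (proj₁ (rep-ends i)) (cong (λ t → t ∸ 1 , fold (inject₁ i)) (sym (toℕ-inject₁ i)))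
  rep-fold i (inj₂ refl) = proj₂ (rep-ends i)

  rep-tl : ∀ i → Z.rep i (tl P (foldEdge i)) ≡ label (tl R i)
  rep-tl i = trans (cong (Z.rep i) (sym (proj₁ (fold-edge i)))) (rep-fold i (tl-incident R i))

  rep-hd : ∀ i → Z.rep i (hd P (foldEdge i)) ≡ label (hd R i)
  rep-hd i = trans (cong (Z.rep i) (sym (proj₂ (fold-edge i)))) (rep-fold i (hd-incident R i))

  Sf≡ : ∀ i → Z.Sf i ≡ struct (label (tl R i) ∷ label (hd R i) ∷ [])
                               ((label (tl R i) , label (hd R i)) ∷ [])
  Sf≡ i rewrite Sℓ≡ i = cong₂ (λ a b → struct (a ∷ b ∷ []) ((a , b) ∷ [])) (rep-tl i) (rep-hd i)

  label-adjacent : ∀ i → label (inject₁ i) ≢ label (suc i)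
  label-adjacent i eq = levelMap-adjacent (proj₁ levQ) i
    (trans (sym (toℕ-fold (inject₁ i))) (trans (cong (toℕ ∘ proj₂) eq) (toℕ-fold (suc i))))

  label-injective : Injective _≡_ _≡_ label
  label-injective {zero}        {zero}        _  = refl
  label-injective {zero}        {suc zero}    eq = ⊥-elim (label-adjacent zero eq)
  label-injective {suc zero}    {zero}        eq = ⊥-elim (label-adjacent zero (sym eq))
  label-injective {zero}        {suc (suc _)} eq with () ← cong proj₁ eq
  label-injective {suc (suc _)} {zero}        eq with () ← cong proj₁ eq
  label-injective {suc _}       {suc _}       eq = cong suc (toℕ-injective (cong proj₁ eq))

  ∈-U-ξ : ∀ x → x ∈ U Z.ξ ⇔ (∃ λ v → label v ≡ x)
  ∈-U-ξ x = mk⇔ to from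
    where
    to : x ∈ U Z.ξ → ∃ λ v → label v ≡ x
    to x∈ξ with Equivalence.to (∈-concatMap-allFin _ (λ i → U (Z.Sf i))) x∈ξ
    ... | i , x∈Sf with subst (λ S → x ∈ U S) (Sf≡ i) x∈Sf
    ... | here x≡         = tl R i , sym x≡
    ... | there (here x≡) = hd R i , sym x≡
    from : (∃ λ v → label v ≡ x) → x ∈ U Z.ξ
    from (v , refl) with incident-cover v
    ... | i , v-inc = Equivalence.from (∈-concatMap-allFin _ (λ i → U (Z.Sf i)))
      (i , subst (λ S → label v ∈ U S) (sym (Sf≡ i)) (tl-or-hd (incident⇒tl⊎hd R i v-inc)))
      where
      tl-or-hd : v ≡ tl R i ⊎ v ≡ hd R i → label v ∈ label (tl R i) ∷ label (hd R i) ∷ []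
      tl-or-hd (inj₁ refl) = here refl
      tl-or-hd (inj₂ refl) = there (here refl)

  ∈-E-ξ : ∀ x y → (x , y) ∈ E Z.ξ ⇔ (∃₂ λ v w → Edge R v w × label v ≡ x × label w ≡ y)
  ∈-E-ξ x y = mk⇔ to from
    where
    to : (x , y) ∈ E Z.ξ → ∃₂ λ v w → Edge R v w × label v ≡ x × label w ≡ y
    to xy∈ξ with Equivalence.to (∈-concatMap-allFin _ (λ i → E (Z.Sf i))) xy∈ξ
    ... | i , xy∈Sf with subst (λ S → (x , y) ∈ E S) (Sf≡ i) xy∈Sf
    ... | here refl = tl R i , hd R i , (i , refl , refl) , refl , refl
    from : (∃₂ λ v w → Edge R v w × label v ≡ x × label w ≡ y) → (x , y) ∈ E Z.ξ
    from (_ , _ , (i , refl , refl) , refl , refl) =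
      Equivalence.from (∈-concatMap-allFin _ (λ i → E (Z.Sf i)))
        (i , subst (λ S → (x , y) ∈ E S) (sym (Sf≡ i)) (here refl))

  ξ≅R : IsoToPath Z.ξ R
  ξ≅R = label , label-injective , ∈-U-ξ , ∈-E-ξ

  record SingleEndFiber (t : Vertex P) : Set where
    field
      point      : Vertex Q
      point-end  : incidence (q Q) point ≡ 1
      fold-point : fold point ≡ t
      only-point : ∀ w → w ≢ point → fold w ≢ t

  end-fiber : ∀ t → t ≡ zero ⊎ toℕ t ≡ nEdges P → SingleEndFiber t
  end-fiber t (inj₁ refl) = record
    { point      = bottom
    ; point-end  = bottom-incidence
    ; fold-point = toℕ-injective (trans (toℕ-fold bottom) bottom-level)
    ; only-point = λ w w≢b fold-w≡0 → <⇒≢ (bottom-unique w w≢b)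
        (trans bottom-level (sym (trans (sym (toℕ-fold w)) (cong toℕ fold-w≡0))))
    }
  end-fiber t (inj₂ t≡n) = record
    { point      = top
    ; point-end  = top-incidence
    ; fold-point = toℕ-injective (trans (toℕ-fold top) (trans top≡n (sym t≡n)))
    ; only-point = λ w w≢t fold-w≡t → <⇒≢ (top-unique w w≢t)
        (trans (trans (sym (toℕ-fold w)) (cong toℕ fold-w≡t)) (trans t≡n (sym top≡n)))
    }

  module Minimality {lP : Vertex P → ℕ} (levP : IsLev P lP) (minP : Minimal P lP) where
    private
      module MP = Minimal minP
      module B = SingleEndFiber (end-fiber MP.bottom (incidence≡1⇒end (q P) _ MP.bottom-incidence))
      module T = SingleEndFiber (end-fiber MP.top (incidence≡1⇒end (q P) _ MP.top-incidence))

    lR : Vertex R → ℕ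
    lR = lP ∘ fold

    minimal-R : Minimal R lR
    minimal-R = record
      { bottom           = B.point
      ; top              = T.point
      ; bottom-incidence = B.point-end
      ; top-incidence    = T.point-end
      ; bottom-level     = trans (cong lP B.fold-point) MP.bottom-level
      ; bottom-unique    = λ w w≢b → subst (_< lR w) (cong lP (sym B.fold-point))
                                       (MP.bottom-unique (fold w) (B.only-point w w≢b))
      ; top-unique       = λ w w≢t → subst (lR w <_) (cong lP (sym T.fold-point))
                                       (MP.top-unique (fold w) (T.only-point w w≢t))
      }

    lev-R : IsLev R lR
    lev-R = levelMap⇒lev (levelMap-∘ (proj₁ levP) fold fold-Edge) B.point (Minimal.bottom-level minimal-R)

    height-R : HasHeight R (lP MP.top)
    height-R = subst (HasHeight R) (cong lP T.fold-point) (Minimal⇒height lev-R minimal-R)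

lemma3 : (P : OPath) → IsMinimal P →
    (Q : OPath) → IsMinimal Q → HasHeight Q (nEdges P) →
    (lQ : Vertex Q → ℕ) → IsLev Q lQ →
    Σ OPath (λ R → IsoToPath (zigzag _≟_ (pathRep P) Q lQ) R × IsMinimal R ×
    ∃ (λ h → HasHeight P h × HasHeight R h))
lemma3 P isMinP@(lP , levP , _) Q isMinQ heightQ lQ levQ =
  R , ξ≅R , Minimal⇒isMinimal lev-R minimal-R ,
  lP (Minimal.top minP) , Minimal⇒height levP minP , height-R
  where
  minP = isMinimal⇒Minimal levP isMinP
  minQ = isMinimal⇒Minimal levQ isMinQ
  open PathRepZigzag P Q lQ levQ minQ (height≡top-level levQ minQ heightQ)
  open Minimality levP minP
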